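{- Let $G_1,\dots,G_k$ be finite simple graphs. Then $(G_1\square\cdots\square G_k)_\delta=(G_1)_\delta\square\cdots\square(G_k)_\delta$ if and only if there is at most one index $i$ such that $G_i\neq K_1$.
   Context: All graphs are finite and simple; $K_1$ is the graph with a single vertex; $d_G(x)$ denotes the degree of $x$ in $G$. The $\delta$-complement $G_\delta$ of a graph $G$ is the graph on $V(G)$ in which distinct $u,v$ are adjacent iff either ($d_G(u)=d_G(v)$ and $uv\notin E(G)$) or ($d_G(u)\neq d_G(v)$ and $uv\in E(G)$). The Cartesian product $G_1\square\cdots\square G_k$ has vertex set $V(G_1)\times\cdots\times V(G_k)$, with $(u_1,\dots,u_k)$ adjacent to $(v_1,\dots,v_k)$ iff there is exactly one index $i$ with $u_i\neq v_i$, and for that index $u_iv_i\in E(G_i)$. -}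

module Defs where

open import Data.Nat using (ℕ; zero; suc; _+_)
import Data.Nat as ℕ
open import Data.Bool using (Bool; true; false; _∧_; _∨_; not; if_then_else_)
open import Data.Fin using (Fin; zero; suc)
import Data.Fin as Fin
open import Data.List using (List; []; _∷_; map; cartesianProduct)
open import Data.Nat.ListAction using (sum)
open import Data.Unit using (⊤; tt)
open import Data.Product using (_×_; _,_)
open import Relation.Binary.PropositionalEquality using (_≡_; refl; cong₂)
open import Relation.Binary.Definitions using (DecidableEquality)
open import Relation.Nullary using (yes; no; Dec)
open import Relation.Nullary.Decidable using (⌊_⌋)

record Graph (n : ℕ) : Set where
  field
    adj    : Fin n → Fin n → Bool
    sym    : ∀ u v → adj u v ≡ adj v u
    irrefl : ∀ v → adj v v ≡ false
open Graph public

-- K₁ : the graph with a single vertex (the only simple graph on Fin 1).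
-- A graph G : Graph n is (equal to) K₁ iff n ≡ 1.
IsK₁ : ∀ {n} → Graph n → Set
IsK₁ {n} _ = n ≡ 1

b2n : Bool → ℕ
b2n true  = 1
b2n false = 0

-- degree of v w.r.t. adjacency a, counting over a duplicate-free complete list of vertices
degIn : {V : Set} → List V → (V → V → Bool) → V → ℕ
degIn vs a v = sum (map (λ u → b2n (a v u)) vs)

δAdj : {V : Set} → DecidableEquality V → List V → (V → V → Bool) → V → V → Bool
δAdj eq vs a u v with eq u v
... | yes _ = false
... | no _  = if ⌊ degIn vs a u ℕ.≟ degIn vs a v ⌋ then not (a u v) else a u v

δAdjG : ∀ {n} → Graph n → Fin n → Fin n → Bool
δAdjG {n} G = δAdj Fin._≟_ (Data.List.Base.allFin n) (adj G)
  where import Data.List.Base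

Tuple : ∀ {k} → (Fin k → ℕ) → Set
Tuple {zero}  n = ⊤
Tuple {suc k} n = Fin (n zero) × Tuple (λ i → n (suc i))

_≟T_ : ∀ {k} {n : Fin k → ℕ} → DecidableEquality (Tuple n)
_≟T_ {zero}  tt tt = yes refl
_≟T_ {suc k} (x , xs) (y , ys) with x Fin.≟ y | xs ≟T ys
... | yes refl | yes refl = yes refl
... | no p     | _        = no λ { refl → p refl }
... | yes _    | no q     = no λ { refl → q refl }

elemsT : ∀ {k} (n : Fin k → ℕ) → List (Tuple n)
elemsT {zero}  n = tt ∷ []
elemsT {suc k} n = cartesianProduct (Data.List.Base.allFin (n zero)) (elemsT (λ i → n (suc i)))
  where import Data.List.Base

□Adj : ∀ {k} {n : Fin k → ℕ} → ((i : Fin k) → Fin (n i) → Fin (n i) → Bool)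
     → Tuple n → Tuple n → Bool
□Adj {zero}  a tt tt = false
□Adj {suc k} a (x , xs) (y , ys) =
  (a zero x y ∧ ⌊ xs ≟T ys ⌋) ∨ (⌊ x Fin.≟ y ⌋ ∧ □Adj (λ i → a (suc i)) xs ys)

productAdj : ∀ {k} {n : Fin k → ℕ} → ((i : Fin k) → Graph (n i)) → Tuple n → Tuple n → Bool
productAdj G = □Adj (λ i → adj (G i))

δOfProductAdj : ∀ {k} {n : Fin k → ℕ} → ((i : Fin k) → Graph (n i)) → Tuple n → Tuple n → Bool
δOfProductAdj {n = n} G = δAdj _≟T_ (elemsT n) (productAdj G)

productOfδAdj : ∀ {k} {n : Fin k → ℕ} → ((i : Fin k) → Graph (n i)) → Tuple n → Tuple n → Bool
productOfδAdj G = □Adj (λ i → δAdjG (G i))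

-- The degree of a vertex of G₁ □ ⋯ □ G_k is the sum of the degrees of its coordinates.
-- Hence two vertices at Hamming distance one have equal degree in the product exactly when
-- the differing coordinates have equal degree in their factor, so the δ-complement commutes
-- with the product on such pairs; pairs at Hamming distance at least two are non-adjacent in
-- both products. Conversely, every graph on m ≥ 2 vertices has two distinct vertices of equal
-- degree, since its degrees lie in {0, …, m − 1} but 0 and m − 1 never both occur. If two
-- factors G_i, G_j are not K₁, choosing such pairs in both gives vertices u, v of the product
-- that differ in coordinates i and j and have equal degree: they are adjacent in
-- (G₁ □ ⋯ □ G_k)_δ but not in (G₁)_δ □ ⋯ □ (G_k)_δ.
module Submission where

open import Defs hiding (sym)
open import Data.Bool using (Bool; true; false; _∧_; _∨_; not; if_then_else_)
open import Data.Bool.Properties using (∧-zeroʳ; ∧-identityʳ; ∨-identityʳ)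
open import Data.Empty using (⊥-elim)
open import Data.Fin using (Fin; zero; suc; fromℕ<; punchIn; punchOut)
import Data.Fin as Fin
import Data.Fin.Properties as Finₚ
open import Data.List using (List; []; _∷_; _++_; map; tabulate; allFin; cartesianProduct)
open import Data.List.Properties using (map-++; map-cong; map-∘)
open import Data.Nat using (ℕ; zero; suc; _+_; _*_; _∸_; _≤_; _<_; z≤n; s≤s)
import Data.Nat as ℕ
open import Data.Nat.ListAction using (sum)
open import Data.Nat.ListAction.Properties using (sum-++)
open import Data.Nat.Properties
open import Algebra.Properties.CommutativeMonoid.Sum +-0-commutativeMonoid
  using (sum-remove) renaming (sum to ∑)
open import Data.Product using (∃₂; _×_; _,_)
open import Data.Unit using (tt)
open import Data.Vec.Functional using (removeAt)
open import Function using (_∘_; id)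
open import Function.Bundles using (_⇔_; mk⇔; Equivalence)
open import Relation.Binary.PropositionalEquality
open import Relation.Binary.Definitions using (DecidableEquality)
open import Relation.Nullary using (Dec; yes; no; ¬_)
open import Relation.Nullary.Decidable using (⌊_⌋; isYes≗does; dec-true; dec-false)
open import Data.Nat.Tactic.RingSolver using (solve-∀)

private
  variable
    k m : ℕ
    n : Fin k → ℕ

isYes-true : {P : Set} (p? : Dec P) → P → ⌊ p? ⌋ ≡ true
isYes-true p? p = trans (isYes≗does p?) (dec-true p? p)

isYes-false : {P : Set} (p? : Dec P) → ¬ P → ⌊ p? ⌋ ≡ false
isYes-false p? ¬p = trans (isYes≗does p?) (dec-false p? ¬p)

isYes-cong : {P Q : Set} (p? : Dec P) (q? : Dec Q) → (P → Q) → (Q → P) → ⌊ p? ⌋ ≡ ⌊ q? ⌋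
isYes-cong (yes p) q? to from = sym (isYes-true q? (to p))
isYes-cong (no ¬p) q? to from = sym (isYes-false q? (¬p ∘ from))

module _ {A : Set} where

  sum-map-cong : {f g : A → ℕ} → (∀ x → f x ≡ g x) → ∀ xs → sum (map f xs) ≡ sum (map g xs)
  sum-map-cong f≗g xs = cong sum (map-cong f≗g xs)

  sum-map-+ : (f g : A → ℕ) (xs : List A) →
    sum (map (λ x → f x + g x) xs) ≡ sum (map f xs) + sum (map g xs)
  sum-map-+ f g []       = refl
  sum-map-+ f g (x ∷ xs) rewrite sum-map-+ f g xs = interchange (f x) (g x) _ _
    where
    interchange : ∀ a b c d → a + b + (c + d) ≡ a + c + (b + d)
    interchange = solve-∀

  sum-map-*ˡ : (c : ℕ) (f : A → ℕ) (xs : List A) → sum (map (λ x → c * f x) xs) ≡ c * sum (map f xs)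
  sum-map-*ˡ c f []       = sym (*-zeroʳ c)
  sum-map-*ˡ c f (x ∷ xs) rewrite sum-map-*ˡ c f xs = sym (*-distribˡ-+ c (f x) _)

  sum-map-*ʳ : (f : A → ℕ) (c : ℕ) (xs : List A) → sum (map (λ x → f x * c) xs) ≡ sum (map f xs) * c
  sum-map-*ʳ f c []       = refl
  sum-map-*ʳ f c (x ∷ xs) rewrite sum-map-*ʳ f c xs = sym (*-distribʳ-+ c (f x) _)

  sum-map-const-0 : (xs : List A) → sum (map (λ _ → 0) xs) ≡ 0
  sum-map-const-0 []       = refl
  sum-map-const-0 (_ ∷ xs) = sum-map-const-0 xs

sum-map-cartesianProduct : {A B : Set} (h : A × B → ℕ) (xs : List A) (ys : List B) →
  sum (map h (cartesianProduct xs ys)) ≡ sum (map (λ x → sum (map (λ y → h (x , y)) ys)) xs)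
sum-map-cartesianProduct h []       ys = refl
sum-map-cartesianProduct h (x ∷ xs) ys = begin
  sum (map h (map (x ,_) ys ++ cartesianProduct xs ys))
    ≡⟨ cong sum (map-++ h (map (x ,_) ys) _) ⟩
  sum (map h (map (x ,_) ys) ++ map h (cartesianProduct xs ys))
    ≡⟨ sum-++ (map h (map (x ,_) ys)) _ ⟩
  sum (map h (map (x ,_) ys)) + sum (map h (cartesianProduct xs ys))
    ≡⟨ cong₂ _+_ (cong sum (sym (map-∘ ys))) (sum-map-cartesianProduct h xs ys) ⟩
  sum (map (λ y → h (x , y)) ys) + sum (map (λ x → sum (map (λ y → h (x , y)) ys)) xs) ∎
  where open ≡-Reasoning

sum-map-cartesianProduct-* : {A B : Set} (f : A → ℕ) (g : B → ℕ) (xs : List A) (ys : List B) →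
  sum (map (λ (x , y) → f x * g y) (cartesianProduct xs ys)) ≡ sum (map f xs) * sum (map g ys)
sum-map-cartesianProduct-* f g xs ys = begin
  sum (map (λ (x , y) → f x * g y) (cartesianProduct xs ys))
    ≡⟨ sum-map-cartesianProduct (λ (x , y) → f x * g y) xs ys ⟩
  sum (map (λ x → sum (map (λ y → f x * g y) ys)) xs)
    ≡⟨ sum-map-cong (λ x → sum-map-*ˡ (f x) g ys) xs ⟩
  sum (map (λ x → f x * sum (map g ys)) xs)
    ≡⟨ sum-map-*ʳ f _ xs ⟩
  sum (map f xs) * sum (map g ys) ∎
  where open ≡-Reasoning

sum-map-tabulate : {A : Set} (f : A → ℕ) (g : Fin m → A) → sum (map f (tabulate g)) ≡ ∑ (f ∘ g)
sum-map-tabulate {zero}  f g = refl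
sum-map-tabulate {suc m} f g = cong (f (g zero) +_) (sum-map-tabulate f (g ∘ suc))

count : (Fin m → Bool) → ℕ
count p = ∑ (b2n ∘ p)

count-removeAt : (p : Fin (suc m) → Bool) (v : Fin (suc m)) → count p ≡ b2n (p v) + count (removeAt p v)
count-removeAt p v = sum-remove (b2n ∘ p)

count-allFalse : (p : Fin m → Bool) → (∀ v → p v ≡ false) → count p ≡ 0
count-allFalse {zero}  p _     = refl
count-allFalse {suc m} p allFalse rewrite allFalse zero = count-allFalse (p ∘ suc) (allFalse ∘ suc)

count-≤ : (p : Fin m → Bool) → count p ≤ m
count-≤ {zero}  p = z≤n
count-≤ {suc m} p = +-mono-≤ (b2n≤1 (p zero)) (count-≤ (p ∘ suc))
  where
  b2n≤1 : ∀ b → b2n b ≤ 1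
  b2n≤1 true  = s≤s z≤n
  b2n≤1 false = z≤n

count-< : (p : Fin m → Bool) (v : Fin m) → p v ≡ false → count p < m
count-< {suc m} p v pv≡false = s≤s (begin
  count p                          ≡⟨ count-removeAt p v ⟩
  b2n (p v) + count (removeAt p v) ≡⟨ cong (λ b → b2n b + count (removeAt p v)) pv≡false ⟩
  count (removeAt p v)             ≤⟨ count-≤ (removeAt p v) ⟩
  m                                ∎)
  where open ≤-Reasoning

count+2≤ : (p : Fin m → Bool) (v w : Fin m) → v ≢ w → p v ≡ false → p w ≡ false →
  2 + count p ≤ m
count+2≤ {suc m} p v w v≢w pv≡false pw≡false = s≤s (begin-strict
  count p                          ≡⟨ count-removeAt p v ⟩
  b2n (p v) + count (removeAt p v) ≡⟨ cong (λ b → b2n b + count (removeAt p v)) pv≡false ⟩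
  count (removeAt p v)             <⟨ count-< (removeAt p v) (punchOut v≢w) pw′≡false ⟩
  m                                ∎)
  where
  open ≤-Reasoning
  pw′≡false : removeAt p v (punchOut v≢w) ≡ false
  pw′≡false = trans (cong p (Finₚ.punchIn-punchOut v≢w)) pw≡false

count≡0⇒false : (p : Fin m → Bool) → count p ≡ 0 → ∀ v → p v ≡ false
count≡0⇒false {suc m} p count≡0 v = b2n≡0 (p v)
  (m+n≡0⇒m≡0 (b2n (p v)) (trans (sym (count-removeAt p v)) count≡0))
  where
  b2n≡0 : ∀ b → b2n b ≡ 0 → b ≡ false
  b2n≡0 false _ = refl

sum-≟ : (x : Fin m) → sum (map (λ y → b2n ⌊ x Fin.≟ y ⌋) (allFin m)) ≡ 1
sum-≟ {suc m} x = begin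
  sum (map (λ y → b2n ⌊ x Fin.≟ y ⌋) (allFin (suc m)))
    ≡⟨ sum-map-tabulate (λ y → b2n ⌊ x Fin.≟ y ⌋) id ⟩
  count (λ y → ⌊ x Fin.≟ y ⌋)
    ≡⟨ count-removeAt (λ y → ⌊ x Fin.≟ y ⌋) x ⟩
  b2n ⌊ x Fin.≟ x ⌋ + count (λ j → ⌊ x Fin.≟ punchIn x j ⌋)
    ≡⟨ cong₂ (λ b c → b2n b + c) (isYes-true (x Fin.≟ x) refl)
             (count-allFalse _ (λ j → isYes-false (x Fin.≟ punchIn x j) (Finₚ.punchInᵢ≢i x j ∘ sym))) ⟩
  1 ∎
  where open ≡-Reasoning

pigeonhole-ℕ : m < k → (f : Fin k → ℕ) → (∀ i → f i < m) → ∃₂ λ i j → i ≢ j × f i ≡ f j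
pigeonhole-ℕ m<k f f<m with Finₚ.pigeonhole m<k (λ i → fromℕ< (f<m i))
... | i , j , i<j , eq = i , j , Finₚ.<⇒≢ i<j , Finₚ.fromℕ<-injective (f i) (f j) (f<m i) (f<m j) eq

-- Graphs and their degrees

deg : Graph m → Fin m → ℕ
deg {m} G = degIn (allFin m) (adj G)

deg≡count : (G : Graph m) (v : Fin m) → deg G v ≡ count (adj G v)
deg≡count G v = sum-map-tabulate (b2n ∘ adj G v) id

deg-< : (G : Graph m) (v : Fin m) → deg G v < m
deg-< G v rewrite deg≡count G v = count-< (adj G v) v (irrefl G v)

deg≡0⇒nonadjacent : (G : Graph m) {w : Fin m} → deg G w ≡ 0 → ∀ v → adj G v w ≡ false
deg≡0⇒nonadjacent G {w} deg≡0 v =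
  trans (Graph.sym G v w) (count≡0⇒false (adj G w) (trans (sym (deg≡count G w)) deg≡0) v)

module _ (G : Graph (suc (suc m))) where

  equalDegrees-isolated : ∀ {w} → deg G w ≡ 0 → ∃₂ λ x y → x ≢ y × deg G x ≡ deg G y
  equalDegrees-isolated {w} isolated = pigeonhole-ℕ ≤-refl (deg G) bound
    where
    -- v ≠ w is adjacent neither to itself nor to the isolated vertex w.
    bound : ∀ v → deg G v < suc m
    bound v with v Fin.≟ w
    ... | yes refl rewrite isolated = s≤s z≤n
    ... | no v≢w rewrite deg≡count G v =
      ≤-pred (count+2≤ (adj G v) v w v≢w (irrefl G v) (deg≡0⇒nonadjacent G isolated v))

  equalDegrees-noIsolated : (∀ v → deg G v ≢ 0) → ∃₂ λ x y → x ≢ y × deg G x ≡ deg G y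
  equalDegrees-noIsolated noIsolated with pigeonhole-ℕ ≤-refl (λ v → deg G v ∸ 1) bound
    where
    bound : ∀ v → deg G v ∸ 1 < suc m
    bound v = ∸-monoˡ-< (deg-< G v) (n≢0⇒n>0 (noIsolated v))
  ... | x , y , x≢y , eq = x , y , x≢y , ∸-cancelʳ-≡ (n≢0⇒n>0 (noIsolated x)) (n≢0⇒n>0 (noIsolated y)) eq

equalDegrees : (G : Graph m) → 2 ≤ m → ∃₂ λ x y → x ≢ y × deg G x ≡ deg G y
equalDegrees {suc zero}    G (s≤s ())
equalDegrees {suc (suc m)} G _ with Finₚ.any? (λ w → deg G w ℕ.≟ 0)
... | yes (w , isolated) = equalDegrees-isolated G isolated
... | no noIsolated      = equalDegrees-noIsolated G (λ v deg≡0 → noIsolated (v , deg≡0))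

lookupT : Tuple n → (i : Fin k) → Fin (n i)
lookupT (x , _)  zero    = x
lookupT (_ , xs) (suc i) = lookupT xs i

infixl 6 _[_]≔_
_[_]≔_ : Tuple n → (i : Fin k) → Fin (n i) → Tuple n
(_ , xs) [ zero  ]≔ y = y , xs
(x , xs) [ suc i ]≔ y = x , xs [ i ]≔ y

lookupT∘update : (i : Fin k) (u : Tuple n) (y : Fin (n i)) → lookupT (u [ i ]≔ y) i ≡ y
lookupT∘update zero    (x , xs) y = refl
lookupT∘update (suc i) (x , xs) y = lookupT∘update i xs y

lookupT∘update′ : {i j : Fin k} → i ≢ j → (u : Tuple n) (y : Fin (n i)) →
  lookupT (u [ i ]≔ y) j ≡ lookupT u j
lookupT∘update′ {i = zero}  {zero}  i≢j _        _ = ⊥-elim (i≢j refl)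
lookupT∘update′ {i = zero}  {suc j} _   (x , xs) _ = refl
lookupT∘update′ {i = suc i} {zero}  _   (x , xs) _ = refl
lookupT∘update′ {i = suc i} {suc j} i≢j (x , xs) y = lookupT∘update′ (i≢j ∘ cong suc) xs y

sumCoords : ((i : Fin k) → Fin (n i) → ℕ) → Tuple n → ℕ
sumCoords {zero}  f tt       = 0
sumCoords {suc k} f (x , xs) = f zero x + sumCoords (f ∘ suc) xs

sumCoords-update : (f : (i : Fin k) → Fin (n i) → ℕ) (u : Tuple n) (i : Fin k) (y : Fin (n i)) →
  sumCoords f (u [ i ]≔ y) + f i (lookupT u i) ≡ sumCoords f u + f i y
sumCoords-update f (x , xs) zero y = swap (f zero y) (sumCoords (f ∘ suc) xs) (f zero x)
  where
  swap : ∀ a b c → a + b + c ≡ c + b + a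
  swap = solve-∀
sumCoords-update f (x , xs) (suc i) y = begin
  f zero x + sumCoords (f ∘ suc) (xs [ i ]≔ y) + f (suc i) (lookupT xs i)
    ≡⟨ +-assoc (f zero x) _ _ ⟩
  f zero x + (sumCoords (f ∘ suc) (xs [ i ]≔ y) + f (suc i) (lookupT xs i))
    ≡⟨ cong (f zero x +_) (sumCoords-update (f ∘ suc) xs i y) ⟩
  f zero x + (sumCoords (f ∘ suc) xs + f (suc i) y)
    ≡⟨ +-assoc (f zero x) _ _ ⟨
  f zero x + sumCoords (f ∘ suc) xs + f (suc i) y ∎
  where open ≡-Reasoning

sumCoords-update-≡⇔ : (f : (i : Fin k) → Fin (n i) → ℕ) (u : Tuple n) (i : Fin k) (y : Fin (n i)) →
  (sumCoords f u ≡ sumCoords f (u [ i ]≔ y)) ⇔ (f i (lookupT u i) ≡ f i y)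
sumCoords-update-≡⇔ f u i y = mk⇔
  (λ eq → +-cancelˡ-≡ (sumCoords f u) _ _ (trans (cong (_+ f i (lookupT u i)) eq) balance))
  (λ eq → sym (+-cancelʳ-≡ (f i y) _ _ (trans (cong (sumCoords f (u [ i ]≔ y) +_) (sym eq)) balance)))
  where
  balance : sumCoords f (u [ i ]≔ y) + f i (lookupT u i) ≡ sumCoords f u + f i y
  balance = sumCoords-update f u i y

data HammingView {n : Fin k → ℕ} (u : Tuple n) : Tuple n → Set where
  equal : HammingView u u
  atOne : (i : Fin k) (y : Fin (n i)) → lookupT u i ≢ y → HammingView u (u [ i ]≔ y)
  atTwo : ∀ {v} (i j : Fin k) → i ≢ j →
          lookupT u i ≢ lookupT v i → lookupT u j ≢ lookupT v j → HammingView u v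

hamming : ∀ {k} {n : Fin k → ℕ} (u v : Tuple n) → HammingView u v
hamming {zero}  tt       tt       = equal
hamming {suc k} (x , xs) (y , ys) with x Fin.≟ y | hamming xs ys
... | yes refl | equal                  = equal
... | yes refl | atOne i y′ xᵢ≢y′       = atOne (suc i) y′ xᵢ≢y′
... | yes refl | atTwo i j i≢j xsᵢ≢ysᵢ xsⱼ≢ysⱼ = atTwo (suc i) (suc j) (i≢j ∘ Finₚ.suc-injective) xsᵢ≢ysᵢ xsⱼ≢ysⱼ
... | no x≢y   | equal                  = atOne zero y x≢y
... | no x≢y   | atOne i y′ xᵢ≢y′       =
  atTwo zero (suc i) (λ ()) x≢y (λ eq → xᵢ≢y′ (trans eq (lookupT∘update i xs y′)))
... | no x≢y   | atTwo i _ _ xsᵢ≢ysᵢ _ = atTwo zero (suc i) (λ ()) x≢y xsᵢ≢ysᵢ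

-- The Cartesian product adjacency

AdjFamily : ∀ {k} → (Fin k → ℕ) → Set
AdjFamily {k} n = (i : Fin k) → Fin (n i) → Fin (n i) → Bool

Irreflexive : ∀ {k} {n : Fin k → ℕ} → AdjFamily n → Set
Irreflexive {k} {n} a = (i : Fin k) (x : Fin (n i)) → a i x x ≡ false

□Adj-irrefl : ∀ {k} {n : Fin k → ℕ} (a : AdjFamily n) → Irreflexive a → (u : Tuple n) → □Adj a u u ≡ false
□Adj-irrefl {zero}  a irr tt = refl
□Adj-irrefl {suc k} a irr (x , xs)
  rewrite irr zero x | isYes-true (x Fin.≟ x) refl = □Adj-irrefl (a ∘ suc) (irr ∘ suc) xs

□Adj-update : ∀ {k} {n : Fin k → ℕ} (a : AdjFamily n) → Irreflexive a →
  (u : Tuple n) (i : Fin k) (y : Fin (n i)) → □Adj a u (u [ i ]≔ y) ≡ a i (lookupT u i) y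
□Adj-update a irr (x , xs) zero y
  rewrite isYes-true (xs ≟T xs) refl | □Adj-irrefl (a ∘ suc) (irr ∘ suc) xs
        | ∧-identityʳ (a zero x y) | ∧-zeroʳ ⌊ x Fin.≟ y ⌋ = ∨-identityʳ (a zero x y)
□Adj-update a irr (x , xs) (suc i) y
  rewrite irr zero x | isYes-true (x Fin.≟ x) refl = □Adj-update (a ∘ suc) (irr ∘ suc) xs i y

□Adj-atTwo : ∀ {k} {n : Fin k → ℕ} (a : AdjFamily n) (u v : Tuple n) (i j : Fin k) → i ≢ j →
  lookupT u i ≢ lookupT v i → lookupT u j ≢ lookupT v j → □Adj a u v ≡ false
□Adj-atTwo a (x , xs) (y , ys) zero zero i≢j _ _ = ⊥-elim (i≢j refl)
□Adj-atTwo a (x , xs) (y , ys) zero (suc j) _ x≢y xsⱼ≢ysⱼ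
  rewrite isYes-false (xs ≟T ys) (xsⱼ≢ysⱼ ∘ cong (λ w → lookupT w j))
        | isYes-false (x Fin.≟ y) x≢y | ∧-zeroʳ (a zero x y) = refl
□Adj-atTwo a u v (suc i) zero i≢j uᵢ≢vᵢ u₀≢v₀ = □Adj-atTwo a u v zero (suc i) (λ ()) u₀≢v₀ uᵢ≢vᵢ
□Adj-atTwo a (x , xs) (y , ys) (suc i) (suc j) i≢j xsᵢ≢ysᵢ xsⱼ≢ysⱼ
  rewrite isYes-false (xs ≟T ys) (xsᵢ≢ysᵢ ∘ cong (λ w → lookupT w i)) | ∧-zeroʳ (a zero x y)
        | □Adj-atTwo (a ∘ suc) xs ys i j (i≢j ∘ cong suc) xsᵢ≢ysᵢ xsⱼ≢ysⱼ = ∧-zeroʳ ⌊ x Fin.≟ y ⌋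

b2n-≟T : ∀ {k} {n : Fin (suc k) → ℕ} (x y : Fin (n zero)) (xs ys : Tuple (n ∘ suc)) →
  b2n ⌊ _≟T_ {n = n} (x , xs) (y , ys) ⌋ ≡ b2n ⌊ x Fin.≟ y ⌋ * b2n ⌊ xs ≟T ys ⌋
b2n-≟T x y xs ys with x Fin.≟ y | xs ≟T ys
... | yes refl | yes refl = refl
... | yes refl | no _     = refl
... | no _     | _        = refl

sum-≟T : ∀ {k} {n : Fin k → ℕ} (u : Tuple n) → sum (map (λ v → b2n ⌊ u ≟T v ⌋) (elemsT n)) ≡ 1
sum-≟T {zero}      tt       = refl
sum-≟T {suc k} {n} (x , xs) = begin
  sum (map (λ v → b2n ⌊ _≟T_ {n = n} (x , xs) v ⌋) (cartesianProduct L M))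
    ≡⟨ sum-map-cong (λ (y , ys) → b2n-≟T x y xs ys) (cartesianProduct L M) ⟩
  sum (map (λ (y , ys) → b2n ⌊ x Fin.≟ y ⌋ * b2n ⌊ xs ≟T ys ⌋) (cartesianProduct L M))
    ≡⟨ sum-map-cartesianProduct-* (λ y → b2n ⌊ x Fin.≟ y ⌋) (λ ys → b2n ⌊ xs ≟T ys ⌋) L M ⟩
  sum (map (λ y → b2n ⌊ x Fin.≟ y ⌋) L) * sum (map (λ ys → b2n ⌊ xs ≟T ys ⌋) M)
    ≡⟨ cong₂ _*_ (sum-≟ x) (sum-≟T xs) ⟩
  1 ∎
  where
  open ≡-Reasoning
  L = allFin (n zero)
  M = elemsT (n ∘ suc)

degIn-□Adj : ∀ {k} {n : Fin k → ℕ} (a : AdjFamily n) → Irreflexive a → (u : Tuple n) →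
  degIn (elemsT n) (□Adj a) u ≡ sumCoords (λ i → degIn (allFin (n i)) (a i)) u
degIn-□Adj {zero}      a irr tt       = refl
degIn-□Adj {suc k} {n} a irr (x , xs) = begin
  sum (map (λ v → b2n (□Adj a (x , xs) v)) (cartesianProduct L M))
    ≡⟨ sum-map-cartesianProduct (λ v → b2n (□Adj a (x , xs) v)) L M ⟩
  sum (map (λ y → sum (map (λ ys → b2n (□Adj a (x , xs) (y , ys))) M)) L)
    ≡⟨ sum-map-cong row L ⟩
  sum (map (λ y → b2n (a zero x y) + b2n ⌊ x Fin.≟ y ⌋ * D) L)
    ≡⟨ sum-map-+ (λ y → b2n (a zero x y)) (λ y → b2n ⌊ x Fin.≟ y ⌋ * D) L ⟩
  d₀ + sum (map (λ y → b2n ⌊ x Fin.≟ y ⌋ * D) L)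
    ≡⟨ cong (d₀ +_) (sum-map-*ʳ (λ y → b2n ⌊ x Fin.≟ y ⌋) D L) ⟩
  d₀ + sum (map (λ y → b2n ⌊ x Fin.≟ y ⌋) L) * D
    ≡⟨ cong (λ c → d₀ + c * D) (sum-≟ x) ⟩
  d₀ + 1 * D
    ≡⟨ cong (d₀ +_) (trans (*-identityˡ D) (degIn-□Adj (a ∘ suc) (irr ∘ suc) xs)) ⟩
  d₀ + sumCoords (λ i → degIn (allFin (n (suc i))) (a (suc i))) xs ∎
  where
  open ≡-Reasoning
  L = allFin (n zero)
  M = elemsT (n ∘ suc)
  D = degIn M (□Adj (a ∘ suc)) xs
  d₀ = degIn L (a zero) x
  -- A neighbour (y , ys) moves either in the first coordinate (ys = xs) or in the others (y = x).
  row : ∀ y → sum (map (λ ys → b2n ((a zero x y ∧ ⌊ xs ≟T ys ⌋) ∨ (⌊ x Fin.≟ y ⌋ ∧ □Adj (a ∘ suc) xs ys))) M)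
            ≡ b2n (a zero x y) + b2n ⌊ x Fin.≟ y ⌋ * D
  row y with x Fin.≟ y
  ... | yes refl rewrite irr zero x = sym (+-identityʳ D)
  ... | no _ with a zero x y
  ...   | true  = trans (sum-map-cong (λ ys → cong b2n (∨-identityʳ ⌊ xs ≟T ys ⌋)) M) (sum-≟T xs)
  ...   | false = sum-map-const-0 M

-- δ-complements

module _ {V : Set} (_≟_ : DecidableEquality V) (vs : List V) (a : V → V → Bool) where

  δAdj-irrefl : (u : V) → δAdj _≟_ vs a u u ≡ false
  δAdj-irrefl u with u ≟ u
  ... | yes _   = refl
  ... | no u≢u = ⊥-elim (u≢u refl)

  δAdj-≢ : {u v : V} → u ≢ v →
    δAdj _≟_ vs a u v ≡ (if ⌊ degIn vs a u ℕ.≟ degIn vs a v ⌋ then not (a u v) else a u v)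
  δAdj-≢ {u} {v} u≢v with u ≟ v
  ... | yes u≡v = ⊥-elim (u≢v u≡v)
  ... | no _    = refl

distinct⇒≢1 : {x y : Fin m} → x ≢ y → m ≢ 1
distinct⇒≢1 {x = zero} {zero} x≢y refl = x≢y refl

≢1⇒2≤ : 1 ≤ m → m ≢ 1 → 2 ≤ m
≢1⇒2≤ {suc zero}    _ m≢1 = ⊥-elim (m≢1 refl)
≢1⇒2≤ {suc (suc m)} _ _   = s≤s (s≤s z≤n)

origin : ∀ {k} (n : Fin k → ℕ) → (∀ i → 1 ≤ n i) → Tuple n
origin {zero}  n _        = tt
origin {suc k} n nonempty = fromℕ< (nonempty zero) , origin (n ∘ suc) (nonempty ∘ suc)

module _ {k} {n : Fin k → ℕ} (G : (i : Fin k) → Graph (n i)) where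

  δAdjG-irrefl : Irreflexive (λ i → δAdjG (G i))
  δAdjG-irrefl i = δAdj-irrefl Fin._≟_ (allFin (n i)) (adj (G i))

  degProduct : Tuple n → ℕ
  degProduct = degIn (elemsT n) (productAdj G)

  degProduct-update-≡⇔ : (u : Tuple n) (i : Fin k) (y : Fin (n i)) →
    (degProduct u ≡ degProduct (u [ i ]≔ y)) ⇔ (deg (G i) (lookupT u i) ≡ deg (G i) y)
  degProduct-update-≡⇔ u i y =
    subst₂ (λ p q → (p ≡ q) ⇔ (deg (G i) (lookupT u i) ≡ deg (G i) y)) (sym (degIn-□Adj adjs irrs u)) (sym (degIn-□Adj adjs irrs (u [ i ]≔ y)))
      (sumCoords-update-≡⇔ (λ i → deg (G i)) u i y)
    where
    adjs = λ i → adj (G i)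
    irrs = λ i → irrefl (G i)

  δ-commutes-atOne : (u : Tuple n) (i : Fin k) (y : Fin (n i)) → lookupT u i ≢ y →
    δOfProductAdj G u (u [ i ]≔ y) ≡ productOfδAdj G u (u [ i ]≔ y)
  δ-commutes-atOne u i y uᵢ≢y = begin
    δOfProductAdj G u v
      ≡⟨ δAdj-≢ _≟T_ (elemsT n) (productAdj G) u≢v ⟩
    (if ⌊ degProduct u ℕ.≟ degProduct v ⌋ then not (productAdj G u v) else productAdj G u v)
      ≡⟨ cong₂ (λ b c → if b then not c else c) sameDegree
               (□Adj-update (λ i → adj (G i)) (λ i → irrefl (G i)) u i y) ⟩
    (if ⌊ deg (G i) uᵢ ℕ.≟ deg (G i) y ⌋ then not (adj (G i) uᵢ y) else adj (G i) uᵢ y)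
      ≡⟨ δAdj-≢ Fin._≟_ (allFin (n i)) (adj (G i)) uᵢ≢y ⟨
    δAdjG (G i) uᵢ y
      ≡⟨ □Adj-update (λ i → δAdjG (G i)) δAdjG-irrefl u i y ⟨
    productOfδAdj G u v ∎
    where
    open ≡-Reasoning
    v = u [ i ]≔ y
    uᵢ = lookupT u i
    u≢v : u ≢ v
    u≢v u≡v = uᵢ≢y (trans (cong (λ w → lookupT w i) u≡v) (lookupT∘update i u y))
    sameDegree = isYes-cong (degProduct u ℕ.≟ degProduct v) (deg (G i) uᵢ ℕ.≟ deg (G i) y)
      (Equivalence.to (degProduct-update-≡⇔ u i y)) (Equivalence.from (degProduct-update-≡⇔ u i y))

  atMostOneNontrivial⇒δ-commutes : (∀ i j → ¬ IsK₁ (G i) → ¬ IsK₁ (G j) → i ≡ j) →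
    ∀ u v → δOfProductAdj G u v ≡ productOfδAdj G u v
  atMostOneNontrivial⇒δ-commutes atMostOne u v with hamming u v
  ... | equal = trans (δAdj-irrefl _≟T_ (elemsT n) (productAdj G) u)
                      (sym (□Adj-irrefl (λ i → δAdjG (G i)) δAdjG-irrefl u))
  ... | atOne i y uᵢ≢y = δ-commutes-atOne u i y uᵢ≢y
  ... | atTwo i j i≢j uᵢ≢vᵢ uⱼ≢vⱼ = ⊥-elim (i≢j (atMostOne i j (distinct⇒≢1 uᵢ≢vᵢ) (distinct⇒≢1 uⱼ≢vⱼ)))

  δ-commutes⇒atMostOneNontrivial : (∀ i → 1 ≤ n i) → (∀ u v → δOfProductAdj G u v ≡ productOfδAdj G u v) →
    ∀ i j → ¬ IsK₁ (G i) → ¬ IsK₁ (G j) → i ≡ j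
  δ-commutes⇒atMostOneNontrivial nonempty commutes i j ¬K₁ᵢ ¬K₁ⱼ with i Fin.≟ j
  ... | yes i≡j = i≡j
  ... | no i≢j
    with equalDegrees (G i) (≢1⇒2≤ (nonempty i) ¬K₁ᵢ) | equalDegrees (G j) (≢1⇒2≤ (nonempty j) ¬K₁ⱼ)
  ... | x , x′ , x≢x′ , dx≡dx′ | y , y′ , y≢y′ , dy≡dy′ = ⊥-elim (true≢false (begin
    true                    ≡⟨ adjacentInδOfProduct ⟨
    δOfProductAdj G u v     ≡⟨ commutes u v ⟩
    productOfδAdj G u v     ≡⟨ □Adj-atTwo (λ i → δAdjG (G i)) u v i j i≢j uᵢ≢vᵢ uⱼ≢vⱼ ⟩
    false                   ∎))
    where
    open ≡-Reasoning
    true≢false : true ≢ false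
    true≢false ()
    lookupᵢ : (w : Tuple n) (a : Fin (n i)) (b : Fin (n j)) → lookupT (w [ i ]≔ a [ j ]≔ b) i ≡ a
    lookupᵢ w a b = trans (lookupT∘update′ (i≢j ∘ sym) (w [ i ]≔ a) b) (lookupT∘update i w a)
    u = origin n nonempty [ i ]≔ x [ j ]≔ y
    w = u [ i ]≔ x′
    v = w [ j ]≔ y′
    uᵢ≢vᵢ : lookupT u i ≢ lookupT v i
    uᵢ≢vᵢ eq = x≢x′ (trans (sym (lookupᵢ (origin n nonempty) x y)) (trans eq (lookupᵢ u x′ y′)))
    uⱼ≢vⱼ : lookupT u j ≢ lookupT v j
    uⱼ≢vⱼ eq = y≢y′ (trans (sym (lookupT∘update j _ y)) (trans eq (lookupT∘update j w y′)))
    -- Passing from u to v replaces x by x′ and then y by y′, each preserving the degree.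
    degProduct-u≡v : degProduct u ≡ degProduct v
    degProduct-u≡v = trans
      (Equivalence.from (degProduct-update-≡⇔ u i x′)
        (trans (cong (deg (G i)) (lookupᵢ (origin n nonempty) x y)) dx≡dx′))
      (Equivalence.from (degProduct-update-≡⇔ w j y′)
        (trans (cong (deg (G j)) (trans (lookupT∘update′ i≢j u x′) (lookupT∘update j _ y))) dy≡dy′))
    adjacentInδOfProduct : δOfProductAdj G u v ≡ true
    adjacentInδOfProduct
      rewrite δAdj-≢ _≟T_ (elemsT n) (productAdj G) (λ u≡v → uᵢ≢vᵢ (cong (λ t → lookupT t i) u≡v))
            | isYes-true (degProduct u ℕ.≟ degProduct v) degProduct-u≡v
            | □Adj-atTwo (λ i → adj (G i)) u v i j i≢j uᵢ≢vᵢ uⱼ≢vⱼ = refl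

mainTheorem4 : (k : ℕ) (n : Fin k → ℕ) (G : (i : Fin k) → Graph (n i))
    → (∀ i → 1 ≤ n i)
    → ((∀ u v → δOfProductAdj G u v ≡ productOfδAdj G u v)
    ⇔ (∀ i j → ¬ IsK₁ (G i) → ¬ IsK₁ (G j) → i ≡ j))
mainTheorem4 k n G nonempty =
  mk⇔ (δ-commutes⇒atMostOneNontrivial G nonempty) (atMostOneNontrivial⇒δ-commutes G)
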